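{- Let $m,n$ be positive integers such that the pair $(n,m)$ is good. Let $u\ge 0$ be the integer with $2^u\,\|\,(m+n)$ (i.e. $2^u\mid m+n$, $2^{u+1}\nmid m+n$), put $\widetilde f(1)=(m+n)/2^u$ (an odd integer), and let $l=1$ if $\widetilde f(1)\equiv 1\pmod 4$ and $l=4$ if $\widetilde f(1)\equiv 3\pmod 4$. Then the pair $(l\,\widetilde f(1),\,4lm)$ is good.
   Context: A pair of positive integers $(A,B)$ is called good if: (i) for every odd prime $p$ dividing $\gcd(A,B)$ we have $p^2\mid B$ but $p^2\nmid A$; and (ii) when $2\mid B$, either $A\equiv 1\pmod 4$ and $B\equiv 0\pmod 4$, or $A\equiv 8,12\pmod{16}$ and $B\equiv 0\pmod{16}$. -}

module Defs where

open import Data.Nat using (ℕ; _*_; _%_; _^_; _≡ᵇ_)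
open import Data.Nat.Divisibility using (_∣_)
open import Data.Nat.Primality using (Prime)
open import Data.Product using (_×_)
open import Data.Sum using (_⊎_)
open import Data.Bool using (if_then_else_)
open import Relation.Binary.PropositionalEquality using (_≡_; _≢_)
open import Relation.Nullary using (¬_)

Good : ℕ → ℕ → Set
Good A B =
  (∀ p → Prime p → p ≢ 2 → p ∣ A → p ∣ B → (p * p ∣ B) × ¬ (p * p ∣ A))
  × (2 ∣ B → ((A % 4 ≡ 1) × (B % 4 ≡ 0))
             ⊎ (((A % 16 ≡ 8) ⊎ (A % 16 ≡ 12)) × (B % 16 ≡ 0)))

lOf : ℕ → ℕ
lOf f = if (f % 4) ≡ᵇ 1 then 1 else 4

{-# OPTIONS --safe #-}
-- Since 2 ^ (u + 1) ∤ m + n, f is odd. As l and 4 l are powers of two, the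
-- odd-prime condition for (l f , 4 l m) reduces to that for (f , m): an odd
-- prime p dividing f and m divides n = (m + n) - m, so goodness of (n , m)
-- gives p² ∣ m and p² ∤ n, and p² ∣ f would give p² ∣ m + n, hence p² ∣ n.
-- At 2: if f ≡ 1 (mod 4) then l f = f and 4 ∣ 4 m; if f ≡ 3 (mod 4) then
-- l f = 4 f ≡ 12 (mod 16) and 16 ∣ 16 m.
module Submission where

open import Defs
open import Data.Nat using (ℕ; _+_; _*_; _^_; _<_; _%_; zero; suc; _≡ᵇ_; s≤s; nonTrivial⇒≢1; nonTrivial⇒n>1)
open import Data.Nat.Properties using (0≢1+n; *-assoc; *-comm; *-identityˡ; +-comm; ≤-antisym)
open import Data.Nat.Divisibility
  using (_∣_; divides; ∣⇒≤; ∣1⇒≡1; ∣-trans; m∣m*n; ∣n⇒∣m*n; ∣m+n∣m⇒∣n; m*n∣⇒m∣; *-monoˡ-∣; *-cancelʳ-∣; m%n≡0⇒n∣m; n∣m⇒m%n≡0)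
open import Data.Nat.DivMod using (m%n<n; m∣n⇒o%n%m≡o%m; m%n*o≡m*o%[n*o])
open import Data.Nat.Primality using (Prime; euclidsLemma; prime⇒nonZero; prime⇒nonTrivial)
open import Data.Product using (_×_; _,_)
open import Data.Sum using (_⊎_; inj₁; inj₂)
open import Data.Bool using (if_then_else_)
open import Data.Empty using (⊥-elim)
open import Relation.Binary.PropositionalEquality using (_≡_; _≢_; refl; sym; trans; cong; subst; module ≡-Reasoning)
open import Relation.Nullary using (¬_)

GoodAtOddPrimes : ℕ → ℕ → Set
GoodAtOddPrimes A B = ∀ p → Prime p → p ≢ 2 → p ∣ A → p ∣ B → (p * p ∣ B) × ¬ (p * p ∣ A)

p≢2⇒p∤2^k : ∀ {p} → Prime p → p ≢ 2 → ∀ k → ¬ p ∣ 2 ^ k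
p≢2⇒p∤2^k p-prime p≢2 zero p∣1 = nonTrivial⇒≢1 {{prime⇒nonTrivial p-prime}} (∣1⇒≡1 p∣1)
p≢2⇒p∤2^k {p} p-prime p≢2 (suc k) p∣2^[1+k] with euclidsLemma 2 (2 ^ k) p-prime p∣2^[1+k]
... | inj₁ p∣2 = p≢2 (≤-antisym (∣⇒≤ p∣2) (nonTrivial⇒n>1 p {{prime⇒nonTrivial p-prime}}))
... | inj₂ p∣2^k = p≢2⇒p∤2^k p-prime p≢2 k p∣2^k

p∣m*n∧p∤m⇒p∣n : ∀ {p m n} → Prime p → p ∣ m * n → ¬ p ∣ m → p ∣ n
p∣m*n∧p∤m⇒p∣n {m = m} {n} p-prime p∣mn p∤m with euclidsLemma m n p-prime p∣mn
... | inj₁ p∣m = ⊥-elim (p∤m p∣m)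
... | inj₂ p∣n = p∣n

p*p∣m*n∧p∤m⇒p*p∣n : ∀ {p m n} → Prime p → p * p ∣ m * n → ¬ p ∣ m → p * p ∣ n
p*p∣m*n∧p∤m⇒p*p∣n {p} {m} p-prime pp∣mn p∤m with p∣m*n∧p∤m⇒p∣n p-prime (m*n∣⇒m∣ p p pp∣mn) p∤m
... | divides q refl = *-monoˡ-∣ p p∣q
  where
  p∣mq : p ∣ m * q
  p∣mq = *-cancelʳ-∣ p {{prime⇒nonZero p-prime}} (subst (p * p ∣_) (sym (*-assoc m q p)) pp∣mn)

  p∣q : p ∣ q
  p∣q = p∣m*n∧p∤m⇒p∣n p-prime p∣mq p∤m

goodAtOddPrimes-2^* : ∀ {a b} → GoodAtOddPrimes a b → ∀ j k → GoodAtOddPrimes (2 ^ j * a) (2 ^ k * b)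
goodAtOddPrimes-2^* good j k p p-prime p≢2 p∣2^ja p∣2^kb
  with good p p-prime p≢2 (p∣m*n∧p∤m⇒p∣n p-prime p∣2^ja (p≢2⇒p∤2^k p-prime p≢2 j))
                     (p∣m*n∧p∤m⇒p∣n p-prime p∣2^kb (p≢2⇒p∤2^k p-prime p≢2 k))
... | pp∣b , pp∤a =
  ∣n⇒∣m*n (2 ^ k) pp∣b ,
  λ pp∣2^ja → pp∤a (p*p∣m*n∧p∤m⇒p*p∣n p-prime pp∣2^ja (p≢2⇒p∤2^k p-prime p≢2 j))

∣m+n⇒goodAtOddPrimes : ∀ {f m n} → GoodAtOddPrimes n m → f ∣ m + n → GoodAtOddPrimes f m
∣m+n⇒goodAtOddPrimes good f∣m+n p p-prime p≢2 p∣f p∣m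
  with good p p-prime p≢2 (∣m+n∣m⇒∣n (∣-trans p∣f f∣m+n) p∣m) p∣m
... | pp∣m , pp∤n = pp∣m , λ pp∣f → pp∤n (∣m+n∣m⇒∣n (∣-trans pp∣f f∣m+n) pp∣m)

2∣m⇒2^[u+1]∣m*2^u : ∀ {m} u → 2 ∣ m → 2 ^ (u + 1) ∣ m * 2 ^ u
2∣m⇒2^[u+1]∣m*2^u {m} u 2∣m = subst (_∣ m * 2 ^ u) (cong (2 ^_) (+-comm 1 u)) (*-monoˡ-∣ (2 ^ u) 2∣m)

2^[u+1]∤m*2^u⇒m%2≡1 : ∀ m u → ¬ 2 ^ (u + 1) ∣ m * 2 ^ u → m % 2 ≡ 1
2^[u+1]∤m*2^u⇒m%2≡1 m u 2^[u+1]∤m*2^u with m % 2 in m%2≡r | m%n<n m 2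
... | 0 | _ = ⊥-elim (2^[u+1]∤m*2^u (2∣m⇒2^[u+1]∣m*2^u u (m%n≡0⇒n∣m m 2 m%2≡r)))
... | 1 | _ = refl
... | suc (suc _) | s≤s (s≤s ())

m%2≡1⇒m%4≡1⊎m%4≡3 : ∀ m → m % 2 ≡ 1 → m % 4 ≡ 1 ⊎ m % 4 ≡ 3
m%2≡1⇒m%4≡1⊎m%4≡3 m m%2≡1 with m % 4 | m%n<n m 4 | m∣n⇒o%n%m≡o%m 2 4 m (divides 2 refl)
... | 0 | _ | 0≡m%2 = ⊥-elim (0≢1+n (trans 0≡m%2 m%2≡1))
... | 1 | _ | _ = inj₁ refl
... | 2 | _ | 0≡m%2 = ⊥-elim (0≢1+n (trans 0≡m%2 m%2≡1))
... | 3 | _ | _ = inj₂ refl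
... | suc (suc (suc (suc _))) | s≤s (s≤s (s≤s (s≤s ()))) | _

m%4≡3⇒4*m%16≡12 : ∀ m → m % 4 ≡ 3 → 4 * m % 16 ≡ 12
m%4≡3⇒4*m%16≡12 m m%4≡3 = begin
  4 * m % 16    ≡⟨ cong (_% 16) (*-comm 4 m) ⟩
  m * 4 % 16    ≡⟨ m%n*o≡m*o%[n*o] m 4 4 ⟨
  m % 4 * 4     ≡⟨ cong (_* 4) m%4≡3 ⟩
  12            ∎
  where open ≡-Reasoning

lOf-cases : ∀ f → f % 2 ≡ 1 → (f % 4 ≡ 1 × lOf f ≡ 1) ⊎ (f % 4 ≡ 3 × lOf f ≡ 4)
lOf-cases f f%2≡1 with m%2≡1⇒m%4≡1⊎m%4≡3 f f%2≡1
... | inj₁ f%4≡1 = inj₁ (f%4≡1 , cong (λ r → if r ≡ᵇ 1 then 1 else 4) f%4≡1)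
... | inj₂ f%4≡3 = inj₂ (f%4≡3 , cong (λ r → if r ≡ᵇ 1 then 1 else 4) f%4≡3)

good-l*f-4*l*m : ∀ {f m l} → GoodAtOddPrimes f m → (f % 4 ≡ 1 × l ≡ 1) ⊎ (f % 4 ≡ 3 × l ≡ 4) →
  Good (l * f) (4 * l * m)
good-l*f-4*l*m {f} {m} good (inj₁ (f%4≡1 , refl)) =
  goodAtOddPrimes-2^* good 0 2 ,
  λ _ → inj₁ (trans (cong (_% 4) (*-identityˡ f)) f%4≡1 , n∣m⇒m%n≡0 (4 * m) 4 (m∣m*n m))
good-l*f-4*l*m {f} {m} good (inj₂ (f%4≡3 , refl)) =
  goodAtOddPrimes-2^* good 2 4 ,
  λ _ → inj₂ (inj₂ (m%4≡3⇒4*m%16≡12 f f%4≡3) , n∣m⇒m%n≡0 (16 * m) 16 (m∣m*n m))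

lemma3p1 : (m n u f : ℕ) → 0 < m → 0 < n → Good n m →
    2 ^ u ∣ m + n → ¬ (2 ^ (u + 1) ∣ m + n) → f * 2 ^ u ≡ m + n →
    Good (lOf f * f) (4 * lOf f * m)
lemma3p1 m n u f _ _ (goodₙₘ , _) _ 2^[u+1]∤m+n f*2^u≡m+n =
  good-l*f-4*l*m (∣m+n⇒goodAtOddPrimes goodₙₘ f∣m+n) (lOf-cases f f-odd)
  where
  f∣m+n : f ∣ m + n
  f∣m+n = subst (f ∣_) f*2^u≡m+n (m∣m*n (2 ^ u))

  f-odd : f % 2 ≡ 1
  f-odd = 2^[u+1]∤m*2^u⇒m%2≡1 f u (subst (λ s → ¬ 2 ^ (u + 1) ∣ s) (sym f*2^u≡m+n) 2^[u+1]∤m+n)
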